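{- Let $G$ be a simple graph with $n$ vertices, maximum degree $\Delta$, minimum degree $\delta$, and let $N_\Delta$, $N_\delta$ be the numbers of vertices of degree $\Delta$ and $\delta$, respectively. Then $$S(G)\ge \frac{2N_\Delta N_\delta}{n}(\Delta-\delta)=\frac{N_\Delta+N_\delta}{n}\,IRD(G),$$ with equality if and only if $G$ is regular or $G$ has exactly two distinct vertex degrees.
   Context: With $m$ the number of edges and $d_1,\dots,d_n$ the vertex degrees, $S(G)=\sum_{i=1}^n\left|d_i-\frac{2m}{n}\right|$. $IRD(G)=\frac{2N_\Delta N_\delta}{N_\delta+N_\Delta}(\Delta-\delta)$. (For a regular graph, $N_\Delta=N_\delta=n$.) -}

module Defs where

open import Data.Bool using (Bool; true; false; if_then_else_; _∧_)
open import Data.Nat as ℕ using (ℕ; zero; suc; _⊔_; _⊓_; _≡ᵇ_; _<ᵇ_)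
open import Data.Fin using (Fin; toℕ) renaming (zero to fzero)
open import Data.List using (List; map; foldr; allFin)
open import Data.Nat.ListAction using (sum)
open import Data.Integer using (ℤ; +_)
open import Data.Rational using (ℚ; _/_; 0ℚ; _+_; _*_; _-_; ∣_∣)
open import Data.Product using (Σ; _×_; ∃)
open import Data.Sum using (_⊎_)
open import Relation.Binary.PropositionalEquality using (_≡_; _≢_)

record SimpleGraph (n : ℕ) : Set where
  field
    adj    : Fin n → Fin n → Bool
    sym    : ∀ i j → adj i j ≡ adj j i
    irrefl : ∀ i → adj i i ≡ false
open SimpleGraph public

countFin : ∀ {n} → (Fin n → Bool) → ℕ
countFin {n} p = sum (map (λ j → if p j then 1 else 0) (allFin n))

deg : ∀ {n} → SimpleGraph n → Fin n → ℕ
deg G i = countFin (adj G i)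

edges : ∀ {n} → SimpleGraph n → ℕ
edges {n} G = sum (map (λ i → countFin (λ j → adj G i j ∧ (toℕ i <ᵇ toℕ j))) (allFin n))

maxDeg : ∀ {k} → SimpleGraph (suc k) → ℕ
maxDeg {k} G = foldr _⊔_ (deg G fzero) (map (deg G) (allFin (suc k)))

minDeg : ∀ {k} → SimpleGraph (suc k) → ℕ
minDeg {k} G = foldr _⊓_ (deg G fzero) (map (deg G) (allFin (suc k)))

NΔ : ∀ {k} → SimpleGraph (suc k) → ℕ
NΔ G = countFin (λ i → deg G i ≡ᵇ maxDeg G)

Nδ : ∀ {k} → SimpleGraph (suc k) → ℕ
Nδ G = countFin (λ i → deg G i ≡ᵇ minDeg G)

ℕ→ℚ : ℕ → ℚ
ℕ→ℚ a = + a / 1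

-- division of an integer by a natural number into ℚ (junk value 0 for denominator 0;
-- only used with nonzero denominators)
divℕ : ℤ → ℕ → ℚ
divℕ a zero = 0ℚ
divℕ a (suc d) = a / suc d

S : ∀ {k} → SimpleGraph (suc k) → ℚ
S {k} G = foldr _+_ 0ℚ
  (map (λ i → ∣ ℕ→ℚ (deg G i) - divℕ (+ (2 ℕ.* edges G)) (suc k) ∣) (allFin (suc k)))

IRD : ∀ {k} → SimpleGraph (suc k) → ℚ
IRD G = divℕ (+ (2 ℕ.* NΔ G ℕ.* Nδ G)) (Nδ G ℕ.+ NΔ G) * (ℕ→ℚ (maxDeg G) - ℕ→ℚ (minDeg G))

Regular : ∀ {n} → SimpleGraph n → Set
Regular G = ∀ i j → deg G i ≡ deg G j

TwoDegrees : ∀ {n} → SimpleGraph n → Set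
TwoDegrees G = Σ ℕ λ a → Σ ℕ λ b → a ≢ b
  × (∀ i → deg G i ≡ a ⊎ deg G i ≡ b)
  × ∃ (λ i → deg G i ≡ a) × ∃ (λ j → deg G j ≡ b)

-- Work with the integers e_i = n d_i - 2m, so that n S(G) = Σ |e_i| and Σ e_i = 0, and put
-- N = N_Δ + N_δ, X = 2 N_Δ N_δ (Δ - δ).  For every integer e the tilted absolute value
-- N |e| + (N_δ - N_Δ) e is nonnegative, equal to 2 N_δ e when e ≥ 0 and to 2 N_Δ (-e)
-- when e ≤ 0.  All vertices of degree Δ share e_i = nΔ - 2m ≥ 0 and all vertices of
-- degree δ share e_i = nδ - 2m ≤ 0, so summing over the vertices (the Σ e_i term
-- vanishes) and keeping only the extremal ones gives
--   n X = 2 N_Δ N_δ ((nΔ - 2m) + (2m - nδ)) ≤ N · n S(G) ≤ n · n S(G).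
-- If Δ > δ then X > 0, so equality forces N = n, i.e. every degree is Δ or δ; conversely
-- in that case both inequalities are equalities.

module Submission where

open import Defs hiding (sym)
open import Data.Nat using (ℕ; suc)
open import Data.Rational using (ℚ; _≤_; _*_)

open import Algebra.Bundles using (CommutativeSemigroup)
open import Algebra.Core using (Op₂)
open import Algebra.Definitions using (Selective)
open import Algebra.Structures using (IsCommutativeMonoid)
open import Data.Bool using (Bool; true; false; if_then_else_; _∧_)
open import Data.Bool.Properties using (∧-identityʳ; ∧-zeroʳ)
open import Data.Empty using (⊥-elim)
open import Data.Fin using (Fin; toℕ) renaming (zero to fzero)
import Data.Fin.Properties as FinP
open import Data.Integer as ℤ using (ℤ; +_; 0ℤ; +≤+; +<+)
import Data.Integer.Properties as ℤP
open import Data.Integer.Tactic.RingSolver using (solve-∀)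
open import Data.List using (List; []; _∷_; map; foldr; allFin; length)
import Data.List.Properties as ListP
open import Data.List.Membership.Propositional using (_∈_)
open import Data.List.Membership.Propositional.Properties
  using (∈-allFin; ∈-map⁺; ∈-map⁻; foldr-selective)
open import Data.List.Relation.Unary.Any as Any using (here; there)
open import Data.Nat as ℕ using (_⊔_; _⊓_; _≡ᵇ_; _<ᵇ_; z≤n; s≤s)
import Data.Nat.Properties as ℕP
open import Data.Product using (_×_; ∃; _,_; proj₁; proj₂)
open import Data.Rational as ℚ using (_/_; toℚᵘ)
import Data.Rational.Properties as ℚP
open import Data.Rational.Unnormalised as ℚᵘ using (mkℚᵘ; *≡*; *≤*)
  renaming (_≃_ to _≃ᵘ_)
import Data.Rational.Unnormalised.Properties as ℚᵘP
open import Data.Sum as Sum using (_⊎_; inj₁; inj₂; [_,_])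
open import Function using (_∘_; id)
open import Function.Bundles using (_⇔_; mk⇔)
open import Function.Construct.Composition using (_⇔-∘_)
open import Level using (0ℓ)
open import Relation.Binary using (tri<; tri≈; tri>)
open import Relation.Binary.PropositionalEquality
  using (_≡_; _≢_; refl; sym; trans; cong; cong₂; subst; subst₂; module ≡-Reasoning)
open import Relation.Nullary using (¬_; yes; no)
open import Relation.Nullary.Decidable using (dec-true; dec-false)

module FoldSum {C : Set} {_∙_ : Op₂ C} {ε : C} (isCM : IsCommutativeMonoid _≡_ _∙_ ε) where

  open IsCommutativeMonoid isCM using (identityˡ; isCommutativeSemigroup)

  private
    commutativeSemigroup : CommutativeSemigroup 0ℓ 0ℓ
    commutativeSemigroup = record { isCommutativeSemigroup = isCommutativeSemigroup }

  open import Algebra.Properties.CommutativeSemigroup commutativeSemigroup using (interchange)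

  ∑ : {A : Set} → (A → C) → List A → C
  ∑ f xs = foldr _∙_ ε (map f xs)

  module _ {A : Set} where

    ∑-cong : ∀ {f g : A → C} → (∀ x → f x ≡ g x) → ∀ xs → ∑ f xs ≡ ∑ g xs
    ∑-cong f≗g []       = refl
    ∑-cong f≗g (x ∷ xs) = cong₂ _∙_ (f≗g x) (∑-cong f≗g xs)

    ∑-distrib : ∀ (f g : A → C) xs → ∑ (λ x → f x ∙ g x) xs ≡ ∑ f xs ∙ ∑ g xs
    ∑-distrib f g []       = sym (identityˡ ε)
    ∑-distrib f g (x ∷ xs) = trans (cong ((f x ∙ g x) ∙_) (∑-distrib f g xs))
                                   (interchange (f x) (g x) (∑ f xs) (∑ g xs))

    ∑-ε : ∀ xs → ∑ (λ (_ : A) → ε) xs ≡ ε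
    ∑-ε []       = refl
    ∑-ε (x ∷ xs) = trans (cong (ε ∙_) (∑-ε xs)) (identityˡ ε)

  ∑-comm : ∀ {A B : Set} (f : A → B → C) xs ys →
           ∑ (λ x → ∑ (f x) ys) xs ≡ ∑ (λ y → ∑ (λ x → f x y) xs) ys
  ∑-comm f []       ys = sym (∑-ε ys)
  ∑-comm f (x ∷ xs) ys = trans (cong (∑ (f x) ys ∙_) (∑-comm f xs ys))
                               (sym (∑-distrib (f x) (λ y → ∑ (λ x → f x y) xs) ys))

  ∑-homo : ∀ {A D : Set} {_◦_ : Op₂ D} {ε′ : D} (h : D → C) →
           h ε′ ≡ ε → (∀ x y → h (x ◦ y) ≡ h x ∙ h y) →
           ∀ (f : A → D) xs → h (foldr _◦_ ε′ (map f xs)) ≡ ∑ (h ∘ f) xs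
  ∑-homo h h-ε h-∙ f []       = h-ε
  ∑-homo h h-ε h-∙ f (x ∷ xs) = trans (h-∙ (f x) _) (cong (h (f x) ∙_) (∑-homo h h-ε h-∙ f xs))

module ℕ∑ = FoldSum ℕP.+-0-isCommutativeMonoid
module ℚ∑ = FoldSum ℚP.+-0-isCommutativeMonoid
open FoldSum ℤP.+-0-isCommutativeMonoid

module _ {A : Set} where

  ∑-*-distribˡ : ∀ c (f : A → ℤ) xs → c ℤ.* ∑ f xs ≡ ∑ (λ x → c ℤ.* f x) xs
  ∑-*-distribˡ c = ∑-homo (c ℤ.*_) (ℤP.*-zeroʳ c) (ℤP.*-distribˡ-+ c)

  pos-∑ : ∀ (f : A → ℕ) xs → + ℕ∑.∑ f xs ≡ ∑ (+_ ∘ f) xs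
  pos-∑ = ∑-homo +_ refl ℤP.pos-+

  ∑-const : ∀ c (xs : List A) → ∑ (λ _ → c) xs ≡ c ℤ.* + length xs
  ∑-const c []       = sym (ℤP.*-zeroʳ c)
  ∑-const c (x ∷ xs) = begin
    c ℤ.+ ∑ (λ _ → c) xs         ≡⟨ cong (ℤ._+_ c) (∑-const c xs) ⟩
    c ℤ.+ c ℤ.* + length xs      ≡⟨ ring c (+ length xs) ⟩
    c ℤ.* (+ 1 ℤ.+ + length xs)  ≡⟨ cong (c ℤ.*_) (ℤP.pos-+ 1 (length xs)) ⟨
    c ℤ.* + length (x ∷ xs)      ∎
    where
    open ≡-Reasoning
    ring : ∀ c m → c ℤ.+ c ℤ.* m ≡ c ℤ.* (+ 1 ℤ.+ m)
    ring = solve-∀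

  ∑-mono-≤ : ∀ {f g : A → ℤ} → (∀ x → f x ℤ.≤ g x) → ∀ xs → ∑ f xs ℤ.≤ ∑ g xs
  ∑-mono-≤ f≤g []       = ℤP.≤-refl
  ∑-mono-≤ f≤g (x ∷ xs) = ℤP.+-mono-≤ (f≤g x) (∑-mono-≤ f≤g xs)

  ∑-mono-< : ∀ {f g : A → ℤ} → (∀ x → f x ℤ.≤ g x) → ∀ {y xs} → y ∈ xs → f y ℤ.< g y →
             ∑ f xs ℤ.< ∑ g xs
  ∑-mono-< f≤g {xs = x ∷ xs} (here refl) fy<gy = ℤP.+-mono-<-≤ fy<gy (∑-mono-≤ f≤g xs)
  ∑-mono-< f≤g {xs = x ∷ xs} (there y∈xs) fy<gy = ℤP.+-mono-≤-< (f≤g x) (∑-mono-< f≤g y∈xs fy<gy)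

∑-allFin-const : ∀ n c → ∑ (λ (_ : Fin n) → c) (allFin n) ≡ c ℤ.* + n
∑-allFin-const n c = trans (∑-const c (allFin n)) (cong (λ m → c ℤ.* + m) (ListP.length-tabulate id))

0≤i*j : ∀ {i j} → 0ℤ ℤ.≤ i → 0ℤ ℤ.≤ j → 0ℤ ℤ.≤ i ℤ.* j
0≤i*j {i} {j} 0≤i 0≤j = subst (ℤ._≤ i ℤ.* j) (ℤP.*-zeroʳ i) (ℤP.*-monoˡ-≤-nonNeg i {{ℤ.nonNegative 0≤i}} 0≤j)

0<i*j : ∀ {i j} → 0ℤ ℤ.< i → 0ℤ ℤ.< j → 0ℤ ℤ.< i ℤ.* j
0<i*j {i} {j} 0<i 0<j = subst (ℤ._< i ℤ.* j) (ℤP.*-zeroʳ i) (ℤP.*-monoˡ-<-pos i {{ℤ.positive 0<i}} 0<j)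

tiltedAbs : ℤ → ℤ → ℤ → ℤ
tiltedAbs p q x = (p ℤ.+ q) ℤ.* + ℤ.∣ x ∣ ℤ.+ (q ℤ.- p) ℤ.* x

module _ (p q : ℤ) where

  tiltedAbs-nonneg : ∀ {x} → 0ℤ ℤ.≤ x → tiltedAbs p q x ≡ + 2 ℤ.* q ℤ.* x
  tiltedAbs-nonneg {x} 0≤x = trans (cong (λ a → (p ℤ.+ q) ℤ.* a ℤ.+ (q ℤ.- p) ℤ.* x) (ℤP.0≤i⇒+∣i∣≡i 0≤x)) (ring p q x)
    where
    ring : ∀ p q x → (p ℤ.+ q) ℤ.* x ℤ.+ (q ℤ.- p) ℤ.* x ≡ + 2 ℤ.* q ℤ.* x
    ring = solve-∀

  tiltedAbs-nonpos : ∀ {x} → x ℤ.≤ 0ℤ → tiltedAbs p q x ≡ + 2 ℤ.* p ℤ.* ℤ.- x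
  tiltedAbs-nonpos {x} x≤0 = trans (cong (λ a → (p ℤ.+ q) ℤ.* a ℤ.+ (q ℤ.- p) ℤ.* x) ∣x∣≡-x) (ring p q x)
    where
    ∣x∣≡-x : + ℤ.∣ x ∣ ≡ ℤ.- x
    ∣x∣≡-x = trans (cong +_ (sym (ℤP.∣-i∣≡∣i∣ x))) (ℤP.0≤i⇒+∣i∣≡i (ℤP.neg-mono-≤ x≤0))
    ring : ∀ p q x → (p ℤ.+ q) ℤ.* ℤ.- x ℤ.+ (q ℤ.- p) ℤ.* x ≡ + 2 ℤ.* p ℤ.* ℤ.- x
    ring = solve-∀

  tiltedAbs-nonNeg : 0ℤ ℤ.≤ p → 0ℤ ℤ.≤ q → ∀ x → 0ℤ ℤ.≤ tiltedAbs p q x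
  tiltedAbs-nonNeg 0≤p 0≤q x with ℤP.≤-total 0ℤ x
  ... | inj₁ 0≤x = subst (0ℤ ℤ.≤_) (sym (tiltedAbs-nonneg 0≤x)) (0≤i*j (0≤i*j {+ 2} (+≤+ z≤n) 0≤q) 0≤x)
  ... | inj₂ x≤0 = subst (0ℤ ℤ.≤_) (sym (tiltedAbs-nonpos x≤0)) (0≤i*j (0≤i*j {+ 2} (+≤+ z≤n) 0≤p) (ℤP.neg-mono-≤ x≤0))

  ∑-tiltedAbs : ∀ {A : Set} (f : A → ℤ) xs →
    ∑ (tiltedAbs p q ∘ f) xs ≡ (p ℤ.+ q) ℤ.* ∑ (λ x → + ℤ.∣ f x ∣) xs ℤ.+ (q ℤ.- p) ℤ.* ∑ f xs
  ∑-tiltedAbs f xs = trans (∑-distrib _ _ xs)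
    (sym (cong₂ ℤ._+_ (∑-*-distribˡ (p ℤ.+ q) _ xs) (∑-*-distribˡ (q ℤ.- p) f xs)))

𝟙 : Bool → ℕ
𝟙 b = if b then 1 else 0

∑-pos : ∀ {A : Set} (f : A → ℕ) {x xs} → x ∈ xs → 0 ℕ.< f x → 0 ℕ.< ℕ∑.∑ f xs
∑-pos f {xs = y ∷ xs} (here refl) 0<fx = ℕP.<-≤-trans 0<fx (ℕP.m≤m+n (f y) _)
∑-pos f {xs = y ∷ xs} (there x∈xs) 0<fx = ℕP.≤-trans (∑-pos f x∈xs 0<fx) (ℕP.m≤n+m _ (f y))

countFin-pos : ∀ {n} (p : Fin n → Bool) i → p i ≡ true → 0 ℕ.< countFin p
countFin-pos p i pi≡true = ∑-pos (𝟙 ∘ p) (∈-allFin i) (subst (λ b → 0 ℕ.< 𝟙 b) (sym pi≡true) (s≤s z≤n))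

module _ {A : Set} (f : A → ℕ) where

  ≤-foldr-⊔ : ∀ b {x xs} → x ∈ xs → f x ℕ.≤ foldr _⊔_ b (map f xs)
  ≤-foldr-⊔ b {xs = xs} x∈xs = ListP.foldr-preservesᵒ
    (λ y z → [ ℕP.m≤n⇒m≤n⊔o z , ℕP.m≤n⇒m≤o⊔n y ]) b (map f xs)
    (inj₂ (Any.map ℕP.≤-reflexive (∈-map⁺ f x∈xs)))

  foldr-⊓-≤ : ∀ b {x xs} → x ∈ xs → foldr _⊓_ b (map f xs) ℕ.≤ f x
  foldr-⊓-≤ b {xs = xs} x∈xs = ListP.foldr-preservesᵒ
    (λ y z → [ ℕP.m≤n⇒m⊓o≤n z , ℕP.m≤n⇒o⊓m≤n y ]) b (map f xs)
    (inj₂ (Any.map (ℕP.≤-reflexive ∘ sym) (∈-map⁺ f x∈xs)))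

  foldr-attained : ∀ {_•_ : Op₂ ℕ} → Selective _≡_ _•_ →
                   ∀ x₀ xs → ∃ λ x → f x ≡ foldr _•_ (f x₀) (map f xs)
  foldr-attained sel x₀ xs with foldr-selective sel (f x₀) (map f xs)
  ... | inj₁ fold≡fx₀ = x₀ , sym fold≡fx₀
  ... | inj₂ fold∈fxs with ∈-map⁻ f fold∈fxs
  ...   | x , _ , fold≡fx = x , sym fold≡fx

module _ {k : ℕ} (G : SimpleGraph (suc k)) where

  deg≤maxDeg : ∀ i → deg G i ℕ.≤ maxDeg G
  deg≤maxDeg i = ≤-foldr-⊔ (deg G) (deg G fzero) (∈-allFin i)

  minDeg≤deg : ∀ i → minDeg G ℕ.≤ deg G i
  minDeg≤deg i = foldr-⊓-≤ (deg G) (deg G fzero) (∈-allFin i)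

  maxDeg-attained : ∃ λ i → deg G i ≡ maxDeg G
  maxDeg-attained = foldr-attained (deg G) ℕP.⊔-sel fzero (allFin (suc k))

  minDeg-attained : ∃ λ i → deg G i ≡ minDeg G
  minDeg-attained = foldr-attained (deg G) ℕP.⊓-sel fzero (allFin (suc k))

<ᵇ-true : ∀ {m n} → m ℕ.< n → (m <ᵇ n) ≡ true
<ᵇ-true {m} {n} = dec-true (m ℕP.<? n)

<ᵇ-false : ∀ {m n} → ¬ m ℕ.< n → (m <ᵇ n) ≡ false
<ᵇ-false {m} {n} = dec-false (m ℕP.<? n)

module _ {n : ℕ} (G : SimpleGraph n) where

  𝟙-adj-split : ∀ i j → 𝟙 (adj G i j)
    ≡ 𝟙 (adj G i j ∧ (toℕ i <ᵇ toℕ j)) ℕ.+ 𝟙 (adj G j i ∧ (toℕ j <ᵇ toℕ i))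
  𝟙-adj-split i j with ℕP.<-cmp (toℕ i) (toℕ j)
  ... | tri< i<j _ j≮i
    rewrite <ᵇ-true i<j | <ᵇ-false j≮i | ∧-identityʳ (adj G i j) | ∧-zeroʳ (adj G j i) =
    sym (ℕP.+-identityʳ _)
  ... | tri≈ _ i≡j _ rewrite FinP.toℕ-injective i≡j | irrefl G j = refl
  ... | tri> i≮j _ j<i
    rewrite <ᵇ-true j<i | <ᵇ-false i≮j | ∧-identityʳ (adj G j i) | ∧-zeroʳ (adj G i j)
          | SimpleGraph.sym G i j = refl

  handshake : ℕ∑.∑ (deg G) (allFin n) ≡ 2 ℕ.* edges G
  handshake = begin
    ℕ∑.∑ (λ i → ℕ∑.∑ (λ j → 𝟙 (adj G i j)) V) V
      ≡⟨ ℕ∑.∑-cong (λ i → trans (ℕ∑.∑-cong (𝟙-adj-split i) V) (ℕ∑.∑-distrib (forward i) (backward i) V)) V ⟩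
    ℕ∑.∑ (λ i → ℕ∑.∑ (forward i) V ℕ.+ ℕ∑.∑ (backward i) V) V
      ≡⟨ ℕ∑.∑-distrib _ _ V ⟩
    edges G ℕ.+ ℕ∑.∑ (λ i → ℕ∑.∑ (backward i) V) V
      ≡⟨ cong (edges G ℕ.+_) (ℕ∑.∑-comm backward V V) ⟩
    edges G ℕ.+ edges G
      ≡⟨ cong (edges G ℕ.+_) (ℕP.+-identityʳ (edges G)) ⟨
    2 ℕ.* edges G ∎
    where
    open ≡-Reasoning
    V : List (Fin n)
    V = allFin n
    forward backward : Fin n → Fin n → ℕ
    forward i j = 𝟙 (adj G i j ∧ (toℕ i <ᵇ toℕ j))
    backward i j = 𝟙 (adj G j i ∧ (toℕ j <ᵇ toℕ i))

Extremal : ∀ {n} → (Fin n → ℕ) → ℕ → ℕ → Set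
Extremal d Δ δ = ∀ i → d i ≡ Δ ⊎ d i ≡ δ

-- dev, spread and gap are n times d i - total / n, S and the lower bound.
module DegreeSequence {k : ℕ} (d : Fin (suc k) → ℕ) (Δ δ : ℕ)
                      (δ≤d : ∀ i → δ ℕ.≤ d i) (d≤Δ : ∀ i → d i ℕ.≤ Δ) where

  n : ℕ
  n = suc k

  V : List (Fin n)
  V = allFin n

  total : ℕ
  total = ℕ∑.∑ d V

  dev : Fin n → ℤ
  dev i = + n ℤ.* + d i ℤ.- + total

  spread : ℤ
  spread = ∑ (λ i → + ℤ.∣ dev i ∣) V

  mult : ℕ → ℕ
  mult v = countFin (λ i → d i ≡ᵇ v)

  gap : ℤ
  gap = + (2 ℕ.* mult Δ ℕ.* mult δ) ℤ.* (+ Δ ℤ.- + δ)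

  ind : ℕ → Fin n → ℤ
  ind v i = + 𝟙 (d i ≡ᵇ v)

  ind-yes : ∀ {v i} → d i ≡ v → ind v i ≡ + 1
  ind-yes {v} {i} di≡v = cong (+_ ∘ 𝟙) (dec-true (d i ℕP.≟ v) di≡v)

  ind-no : ∀ {v i} → d i ≢ v → ind v i ≡ 0ℤ
  ind-no {v} {i} di≢v = cong (+_ ∘ 𝟙) (dec-false (d i ℕP.≟ v) di≢v)

  ∑-ind : ∀ v → ∑ (ind v) V ≡ + mult v
  ∑-ind v = sym (pos-∑ (λ i → 𝟙 (d i ≡ᵇ v)) V)

  mult-pos : ∀ {v} → (∃ λ i → d i ≡ v) → 0 ℕ.< mult v
  mult-pos {v} (i , di≡v) = countFin-pos (λ j → d j ≡ᵇ v) i (dec-true (d i ℕP.≟ v) di≡v)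

  ∑-d : ∑ (+_ ∘ d) V ≡ + total
  ∑-d = sym (pos-∑ d V)

  ∑-dev : ∑ dev V ≡ 0ℤ
  ∑-dev = begin
    ∑ dev V
      ≡⟨ ∑-distrib (λ i → + n ℤ.* + d i) (λ _ → ℤ.- + total) V ⟩
    ∑ (λ i → + n ℤ.* + d i) V ℤ.+ ∑ (λ _ → ℤ.- + total) V
      ≡⟨ cong₂ ℤ._+_ (trans (sym (∑-*-distribˡ (+ n) (+_ ∘ d) V)) (cong (+ n ℤ.*_) ∑-d)) (∑-allFin-const n (ℤ.- + total)) ⟩
    + n ℤ.* + total ℤ.+ ℤ.- + total ℤ.* + n
      ≡⟨ ring (+ n) (+ total) ⟩
    0ℤ ∎
    where
    open ≡-Reasoning
    ring : ∀ n t → n ℤ.* t ℤ.+ ℤ.- t ℤ.* n ≡ 0ℤ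
    ring = solve-∀

  nδ≤total : + n ℤ.* + δ ℤ.≤ + total
  nδ≤total = subst₂ ℤ._≤_ (trans (∑-allFin-const n (+ δ)) (ℤP.*-comm (+ δ) (+ n))) ∑-d
                          (∑-mono-≤ (λ i → +≤+ (δ≤d i)) V)

  total≤nΔ : + total ℤ.≤ + n ℤ.* + Δ
  total≤nΔ = subst₂ ℤ._≤_ ∑-d (trans (∑-allFin-const n (+ Δ)) (ℤP.*-comm (+ Δ) (+ n)))
                          (∑-mono-≤ (λ i → +≤+ (d≤Δ i)) V)

  spread-nonNeg : 0ℤ ℤ.≤ spread
  spread-nonNeg = subst (ℤ._≤ spread) (∑-ε V) (∑-mono-≤ (λ i → +≤+ z≤n) V)

  module Constant (Δ≡δ : Δ ≡ δ) where

    d≡Δ : ∀ i → d i ≡ Δ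
    d≡Δ i = ℕP.≤-antisym (d≤Δ i) (subst (ℕ._≤ d i) (sym Δ≡δ) (δ≤d i))

    gap≡0 : gap ≡ 0ℤ
    gap≡0 = trans (cong (c ℤ.*_) (ℤP.i≡j⇒i-j≡0 (cong +_ Δ≡δ))) (ℤP.*-zeroʳ c)
      where
      c : ℤ
      c = + (2 ℕ.* mult Δ ℕ.* mult δ)

    dev≡0 : ∀ i → dev i ≡ 0ℤ
    dev≡0 i = begin
      + n ℤ.* + d i ℤ.- + total   ≡⟨ cong₂ (λ v t → + n ℤ.* + v ℤ.- t) (d≡Δ i) total≡ ⟩
      + n ℤ.* + Δ ℤ.- + Δ ℤ.* + n ≡⟨ ring (+ n) (+ Δ) ⟩
      0ℤ                          ∎
      where
      open ≡-Reasoning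
      total≡ : + total ≡ + Δ ℤ.* + n
      total≡ = trans (sym ∑-d) (trans (∑-cong (cong +_ ∘ d≡Δ) V) (∑-allFin-const n (+ Δ)))
      ring : ∀ n v → n ℤ.* v ℤ.- v ℤ.* n ≡ 0ℤ
      ring = solve-∀

    spread≡0 : spread ≡ 0ℤ
    spread≡0 = trans (∑-cong (λ i → cong (λ x → + ℤ.∣ x ∣) (dev≡0 i)) V) (∑-ε V)

  module Distinct (Δ≢δ : Δ ≢ δ) where

    excess deficit : ℤ
    excess = + n ℤ.* + Δ ℤ.- + total
    deficit = + total ℤ.- + n ℤ.* + δ

    ≡Δ⇒≢δ : ∀ {i} → d i ≡ Δ → d i ≢ δ
    ≡Δ⇒≢δ di≡Δ di≡δ = Δ≢δ (trans (sym di≡Δ) di≡δ)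

    ≡δ⇒≢Δ : ∀ {i} → d i ≡ δ → d i ≢ Δ
    ≡δ⇒≢Δ di≡δ di≡Δ = ≡Δ⇒≢δ di≡Δ di≡δ

    N : ℤ
    N = + mult Δ ℤ.+ + mult δ

    wΔ wδ : ℤ
    wΔ = + 2 ℤ.* + mult δ ℤ.* excess
    wδ = + 2 ℤ.* + mult Δ ℤ.* deficit

    tilted weight : Fin n → ℤ
    tilted i = tiltedAbs (+ mult Δ) (+ mult δ) (dev i)
    weight i = wΔ ℤ.* ind Δ i ℤ.+ wδ ℤ.* ind δ i

    ∑-tilted : ∑ tilted V ≡ N ℤ.* spread
    ∑-tilted = begin
      ∑ tilted V                                                   ≡⟨ ∑-tiltedAbs (+ mult Δ) (+ mult δ) dev V ⟩
      N ℤ.* spread ℤ.+ (+ mult δ ℤ.- + mult Δ) ℤ.* ∑ dev V         ≡⟨ cong (λ s → N ℤ.* spread ℤ.+ (+ mult δ ℤ.- + mult Δ) ℤ.* s) ∑-dev ⟩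
      N ℤ.* spread ℤ.+ (+ mult δ ℤ.- + mult Δ) ℤ.* 0ℤ               ≡⟨ ring (N ℤ.* spread) (+ mult δ ℤ.- + mult Δ) ⟩
      N ℤ.* spread                                                 ∎
      where
      open ≡-Reasoning
      ring : ∀ a c → a ℤ.+ c ℤ.* 0ℤ ≡ a
      ring = solve-∀

    gap≡ : gap ≡ + 2 ℤ.* + mult Δ ℤ.* + mult δ ℤ.* (+ Δ ℤ.- + δ)
    gap≡ = cong (ℤ._* (+ Δ ℤ.- + δ))
                (trans (ℤP.pos-* (2 ℕ.* mult Δ) (mult δ)) (cong (ℤ._* + mult δ) (ℤP.pos-* 2 (mult Δ))))

    ∑-weight : ∑ weight V ≡ + n ℤ.* gap
    ∑-weight = begin
      ∑ weight V
        ≡⟨ ∑-distrib (λ i → wΔ ℤ.* ind Δ i) (λ i → wδ ℤ.* ind δ i) V ⟩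
      ∑ (λ i → wΔ ℤ.* ind Δ i) V ℤ.+ ∑ (λ i → wδ ℤ.* ind δ i) V
        ≡⟨ cong₂ ℤ._+_ (trans (sym (∑-*-distribˡ wΔ (ind Δ) V)) (cong (wΔ ℤ.*_) (∑-ind Δ)))
                       (trans (sym (∑-*-distribˡ wδ (ind δ) V)) (cong (wδ ℤ.*_) (∑-ind δ))) ⟩
      wΔ ℤ.* + mult Δ ℤ.+ wδ ℤ.* + mult δ
        ≡⟨ ring (+ n) (+ Δ) (+ δ) (+ total) (+ mult Δ) (+ mult δ) ⟩
      + n ℤ.* (+ 2 ℤ.* + mult Δ ℤ.* + mult δ ℤ.* (+ Δ ℤ.- + δ))
        ≡⟨ cong (+ n ℤ.*_) gap≡ ⟨
      + n ℤ.* gap ∎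
      where
      open ≡-Reasoning
      ring : ∀ n Δ δ t a b →
        + 2 ℤ.* b ℤ.* (n ℤ.* Δ ℤ.- t) ℤ.* a ℤ.+ + 2 ℤ.* a ℤ.* (t ℤ.- n ℤ.* δ) ℤ.* b
          ≡ n ℤ.* (+ 2 ℤ.* a ℤ.* b ℤ.* (Δ ℤ.- δ))
      ring = solve-∀

    dev-at-Δ : ∀ {i} → d i ≡ Δ → dev i ≡ excess
    dev-at-Δ di≡Δ = cong (λ v → + n ℤ.* + v ℤ.- + total) di≡Δ

    dev-at-δ : ∀ {i} → d i ≡ δ → dev i ≡ ℤ.- deficit
    dev-at-δ di≡δ = trans (cong (λ v → + n ℤ.* + v ℤ.- + total) di≡δ) (ring (+ n ℤ.* + δ) (+ total))
      where
      ring : ∀ a t → a ℤ.- t ≡ ℤ.- (t ℤ.- a)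
      ring = solve-∀

    weight-at-Δ : ∀ {i} → d i ≡ Δ → weight i ≡ tilted i
    weight-at-Δ {i} di≡Δ = begin
      wΔ ℤ.* ind Δ i ℤ.+ wδ ℤ.* ind δ i  ≡⟨ cong₂ (λ a b → wΔ ℤ.* a ℤ.+ wδ ℤ.* b) (ind-yes di≡Δ) (ind-no (≡Δ⇒≢δ di≡Δ)) ⟩
      wΔ ℤ.* + 1 ℤ.+ wδ ℤ.* 0ℤ          ≡⟨ ring wΔ wδ ⟩
      wΔ                                ≡⟨ tiltedAbs-nonneg (+ mult Δ) (+ mult δ) (ℤP.i≤j⇒0≤j-i total≤nΔ) ⟨
      tiltedAbs (+ mult Δ) (+ mult δ) excess ≡⟨ cong (tiltedAbs (+ mult Δ) (+ mult δ)) (dev-at-Δ di≡Δ) ⟨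
      tilted i                          ∎
      where
      open ≡-Reasoning
      ring : ∀ a b → a ℤ.* + 1 ℤ.+ b ℤ.* 0ℤ ≡ a
      ring = solve-∀

    weight-at-δ : ∀ {i} → d i ≡ δ → weight i ≡ tilted i
    weight-at-δ {i} di≡δ = begin
      wΔ ℤ.* ind Δ i ℤ.+ wδ ℤ.* ind δ i  ≡⟨ cong₂ (λ a b → wΔ ℤ.* a ℤ.+ wδ ℤ.* b) (ind-no (≡δ⇒≢Δ di≡δ)) (ind-yes di≡δ) ⟩
      wΔ ℤ.* 0ℤ ℤ.+ wδ ℤ.* + 1          ≡⟨ ring wΔ wδ ⟩
      + 2 ℤ.* + mult Δ ℤ.* deficit       ≡⟨ cong (+ 2 ℤ.* + mult Δ ℤ.*_) (ℤP.neg-involutive deficit) ⟨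
      + 2 ℤ.* + mult Δ ℤ.* ℤ.- ℤ.- deficit ≡⟨ tiltedAbs-nonpos (+ mult Δ) (+ mult δ) (ℤP.neg-mono-≤ (ℤP.i≤j⇒0≤j-i nδ≤total)) ⟨
      tiltedAbs (+ mult Δ) (+ mult δ) (ℤ.- deficit) ≡⟨ cong (tiltedAbs (+ mult Δ) (+ mult δ)) (dev-at-δ di≡δ) ⟨
      tilted i                          ∎
      where
      open ≡-Reasoning
      ring : ∀ a b → a ℤ.* 0ℤ ℤ.+ b ℤ.* + 1 ≡ b
      ring = solve-∀

    weight-other : ∀ {i} → d i ≢ Δ → d i ≢ δ → weight i ≡ 0ℤ
    weight-other di≢Δ di≢δ = trans (cong₂ (λ a b → wΔ ℤ.* a ℤ.+ wδ ℤ.* b) (ind-no di≢Δ) (ind-no di≢δ)) (ring wΔ wδ)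
      where
      ring : ∀ a b → a ℤ.* 0ℤ ℤ.+ b ℤ.* 0ℤ ≡ 0ℤ
      ring = solve-∀

    weight≤tilted : ∀ i → weight i ℤ.≤ tilted i
    weight≤tilted i with d i ℕP.≟ Δ | d i ℕP.≟ δ
    ... | yes di≡Δ | _        = ℤP.≤-reflexive (weight-at-Δ di≡Δ)
    ... | no _     | yes di≡δ = ℤP.≤-reflexive (weight-at-δ di≡δ)
    ... | no di≢Δ  | no di≢δ  = subst (ℤ._≤ tilted i) (sym (weight-other di≢Δ di≢δ))
                                      (tiltedAbs-nonNeg (+ mult Δ) (+ mult δ) (+≤+ z≤n) (+≤+ z≤n) (dev i))

    extremal-ind : Fin n → ℤ
    extremal-ind i = ind Δ i ℤ.+ ind δ i

    extremal-ind-at : ∀ {i} → d i ≡ Δ ⊎ d i ≡ δ → extremal-ind i ≡ + 1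
    extremal-ind-at (inj₁ di≡Δ) = cong₂ ℤ._+_ (ind-yes di≡Δ) (ind-no (≡Δ⇒≢δ di≡Δ))
    extremal-ind-at (inj₂ di≡δ) = cong₂ ℤ._+_ (ind-no (≡δ⇒≢Δ di≡δ)) (ind-yes di≡δ)

    extremal-ind-other : ∀ {i} → d i ≢ Δ → d i ≢ δ → extremal-ind i ≡ 0ℤ
    extremal-ind-other di≢Δ di≢δ = cong₂ ℤ._+_ (ind-no di≢Δ) (ind-no di≢δ)

    extremal-ind≤1 : ∀ i → extremal-ind i ℤ.≤ + 1
    extremal-ind≤1 i with d i ℕP.≟ Δ | d i ℕP.≟ δ
    ... | yes di≡Δ | _        = ℤP.≤-reflexive (extremal-ind-at (inj₁ di≡Δ))
    ... | no _     | yes di≡δ = ℤP.≤-reflexive (extremal-ind-at (inj₂ di≡δ))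
    ... | no di≢Δ  | no di≢δ  = subst (ℤ._≤ + 1) (sym (extremal-ind-other di≢Δ di≢δ)) (+≤+ z≤n)

    ∑-extremal-ind : ∑ extremal-ind V ≡ N
    ∑-extremal-ind = trans (∑-distrib (ind Δ) (ind δ) V) (cong₂ ℤ._+_ (∑-ind Δ) (∑-ind δ))

    ∑-one : ∑ (λ _ → + 1) V ≡ + n
    ∑-one = trans (∑-allFin-const n (+ 1)) (ℤP.*-identityˡ (+ n))

    N≤n : N ℤ.≤ + n
    N≤n = subst₂ ℤ._≤_ ∑-extremal-ind ∑-one (∑-mono-≤ extremal-ind≤1 V)

    N<n : ∀ {i} → d i ≢ Δ → d i ≢ δ → N ℤ.< + n
    N<n {i} di≢Δ di≢δ = subst₂ ℤ._<_ ∑-extremal-ind ∑-one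
      (∑-mono-< extremal-ind≤1 (∈-allFin i) (subst (ℤ._< + 1) (sym (extremal-ind-other di≢Δ di≢δ)) (+<+ (s≤s z≤n))))

    N≡n : Extremal d Δ δ → N ≡ + n
    N≡n extremal = trans (sym ∑-extremal-ind) (trans (∑-cong (extremal-ind-at ∘ extremal) V) ∑-one)

    n*gap≤N*spread : + n ℤ.* gap ℤ.≤ N ℤ.* spread
    n*gap≤N*spread = subst₂ ℤ._≤_ ∑-weight ∑-tilted (∑-mono-≤ weight≤tilted V)

    gap≤spread : gap ℤ.≤ spread
    gap≤spread = ℤP.*-cancelˡ-≤-pos gap spread (+ n)
      (ℤP.≤-trans n*gap≤N*spread (ℤP.*-monoʳ-≤-nonNeg spread {{ℤ.nonNegative spread-nonNeg}} N≤n))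

    extremal⇒spread≡gap : Extremal d Δ δ → spread ≡ gap
    extremal⇒spread≡gap extremal = sym (ℤP.*-cancelˡ-≡ (+ n) gap spread (begin
      + n ℤ.* gap    ≡⟨ ∑-weight ⟨
      ∑ weight V     ≡⟨ ∑-cong {f = weight} {g = tilted} (λ i → [ weight-at-Δ {i} , weight-at-δ {i} ] (extremal i)) V ⟩
      ∑ tilted V     ≡⟨ ∑-tilted ⟩
      N ℤ.* spread   ≡⟨ cong (ℤ._* spread) (N≡n extremal) ⟩
      + n ℤ.* spread ∎))
      where open ≡-Reasoning

    module _ (Δ-attained : ∃ λ i → d i ≡ Δ) (δ-attained : ∃ λ i → d i ≡ δ) where

      0<gap : 0ℤ ℤ.< gap
      0<gap = subst (0ℤ ℤ.<_) (sym gap≡)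
        (0<i*j (0<i*j (0<i*j {+ 2} (+<+ (s≤s z≤n)) (+<+ (mult-pos Δ-attained))) (+<+ (mult-pos δ-attained))) 0<Δ-δ)
        where
        δ<Δ : δ ℕ.< Δ
        δ<Δ = ℕP.≤∧≢⇒< (ℕP.≤-trans (δ≤d fzero) (d≤Δ fzero)) (Δ≢δ ∘ sym)
        0<Δ-δ : 0ℤ ℤ.< + Δ ℤ.- + δ
        0<Δ-δ = subst (0ℤ ℤ.<_) (sym (trans (ℤP.m-n≡m⊖n Δ δ) (ℤP.⊖-≥ (ℕP.<⇒≤ δ<Δ)))) (+<+ (ℕP.m<n⇒0<n∸m δ<Δ))

      spread≡gap⇒extremal : spread ≡ gap → Extremal d Δ δ
      spread≡gap⇒extremal spread≡gap i with d i ℕP.≟ Δ | d i ℕP.≟ δ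
      ... | yes di≡Δ | _        = inj₁ di≡Δ
      ... | no _     | yes di≡δ = inj₂ di≡δ
      ... | no di≢Δ  | no di≢δ  = ⊥-elim (ℤP.<-irrefl refl (ℤP.<-≤-trans
            (ℤP.*-monoʳ-<-pos gap {{ℤ.positive 0<gap}} (N<n di≢Δ di≢δ))
            (subst (+ n ℤ.* gap ℤ.≤_) (cong (N ℤ.*_) spread≡gap) n*gap≤N*spread)))

  gap≤spread : gap ℤ.≤ spread
  gap≤spread with Δ ℕP.≟ δ
  ... | yes Δ≡δ = subst (ℤ._≤ spread) (sym (Constant.gap≡0 Δ≡δ)) spread-nonNeg
  ... | no Δ≢δ  = Distinct.gap≤spread Δ≢δ

  spread≡gap⇔extremal : (∃ λ i → d i ≡ Δ) → (∃ λ i → d i ≡ δ) → (spread ≡ gap) ⇔ Extremal d Δ δ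
  spread≡gap⇔extremal Δ-attained δ-attained with Δ ℕP.≟ δ
  ... | yes Δ≡δ = mk⇔ (λ _ → inj₁ ∘ Constant.d≡Δ Δ≡δ)
                      (λ _ → trans (Constant.spread≡0 Δ≡δ) (sym (Constant.gap≡0 Δ≡δ)))
  ... | no Δ≢δ  = mk⇔ (Distinct.spread≡gap⇒extremal Δ≢δ Δ-attained δ-attained)
                      (Distinct.extremal⇒spread≡gap Δ≢δ)

between-two-values : ∀ {a b x Δ δ} → δ ℕ.≤ x → x ℕ.≤ Δ →
  x ≡ a ⊎ x ≡ b → Δ ≡ a ⊎ Δ ≡ b → δ ≡ a ⊎ δ ≡ b → x ≡ Δ ⊎ x ≡ δ
between-two-values _   _   (inj₁ refl) (inj₁ refl) _           = inj₁ refl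
between-two-values _   _   (inj₁ refl) (inj₂ refl) (inj₁ refl) = inj₂ refl
between-two-values δ≤x x≤Δ (inj₁ refl) (inj₂ refl) (inj₂ refl) = inj₁ (ℕP.≤-antisym x≤Δ δ≤x)
between-two-values _   _   (inj₂ refl) (inj₂ refl) _           = inj₁ refl
between-two-values _   _   (inj₂ refl) (inj₁ refl) (inj₂ refl) = inj₂ refl
between-two-values δ≤x x≤Δ (inj₂ refl) (inj₁ refl) (inj₁ refl) = inj₁ (ℕP.≤-antisym x≤Δ δ≤x)

module _ {k : ℕ} (G : SimpleGraph (suc k)) where

  extremal⇔regular⊎twoDegrees : Extremal (deg G) (maxDeg G) (minDeg G) ⇔ (Regular G ⊎ TwoDegrees G)
  extremal⇔regular⊎twoDegrees = mk⇔ to from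
    where
    to : Extremal (deg G) (maxDeg G) (minDeg G) → Regular G ⊎ TwoDegrees G
    to extremal with maxDeg G ℕP.≟ minDeg G
    ... | yes Δ≡δ = inj₁ (λ i j → trans (≡Δ i) (sym (≡Δ j)))
      where
      ≡Δ : ∀ i → deg G i ≡ maxDeg G
      ≡Δ i = [ id , (λ di≡δ → trans di≡δ (sym Δ≡δ)) ] (extremal i)
    ... | no Δ≢δ = inj₂ (maxDeg G , minDeg G , Δ≢δ , extremal , maxDeg-attained G , minDeg-attained G)

    from : Regular G ⊎ TwoDegrees G → Extremal (deg G) (maxDeg G) (minDeg G)
    from regular⊎two i with maxDeg-attained G | minDeg-attained G
    from (inj₁ regular) i | iΔ , iΔ-max | _ = inj₁ (trans (regular i iΔ) iΔ-max)
    from (inj₂ (a , b , _ , values , _ , _)) i | iΔ , iΔ-max | iδ , iδ-min =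
      between-two-values (minDeg≤deg G i) (deg≤maxDeg G i) (values i)
        (Sum.map (trans (sym iΔ-max)) (trans (sym iΔ-max)) (values iΔ))
        (Sum.map (trans (sym iδ-min)) (trans (sym iδ-min)) (values iδ))

ℤ→ℚ : ℤ → ℚ
ℤ→ℚ z = z / 1

toℚᵘ-/ : ∀ z k → toℚᵘ (z / suc k) ≃ᵘ mkℚᵘ z k
toℚᵘ-/ z k = ℚP.toℚᵘ-fromℚᵘ (mkℚᵘ z k)

toℚᵘ-ℤ→ℚ : ∀ z → toℚᵘ (ℤ→ℚ z) ≃ᵘ mkℚᵘ z 0
toℚᵘ-ℤ→ℚ z = toℚᵘ-/ z 0

toℚᵘ≃⇒≡ℤ→ℚ : ∀ {p z} → toℚᵘ p ≃ᵘ mkℚᵘ z 0 → p ≡ ℤ→ℚ z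
toℚᵘ≃⇒≡ℤ→ℚ {p} {z} p≃z = ℚP.toℚᵘ-injective (ℚᵘP.≃-trans p≃z (ℚᵘP.≃-sym (toℚᵘ-ℤ→ℚ z)))

module _ where
  open ℚᵘP.≃-Reasoning

  ℤ→ℚ-homo-+ : ∀ a b → ℤ→ℚ (a ℤ.+ b) ≡ ℤ→ℚ a ℚ.+ ℤ→ℚ b
  ℤ→ℚ-homo-+ a b = sym (toℚᵘ≃⇒≡ℤ→ℚ (begin
    toℚᵘ (ℤ→ℚ a ℚ.+ ℤ→ℚ b)          ≈⟨ ℚP.toℚᵘ-homo-+ (ℤ→ℚ a) (ℤ→ℚ b) ⟩
    toℚᵘ (ℤ→ℚ a) ℚᵘ.+ toℚᵘ (ℤ→ℚ b)  ≈⟨ ℚᵘP.+-cong (toℚᵘ-ℤ→ℚ a) (toℚᵘ-ℤ→ℚ b) ⟩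
    mkℚᵘ a 0 ℚᵘ.+ mkℚᵘ b 0           ≈⟨ *≡* (cross a b) ⟩
    mkℚᵘ (a ℤ.+ b) 0                 ∎))
    where
    cross : ∀ a b → (a ℤ.* + 1 ℤ.+ b ℤ.* + 1) ℤ.* + 1 ≡ (a ℤ.+ b) ℤ.* + 1
    cross = solve-∀

  ℤ→ℚ-homo-* : ∀ a b → ℤ→ℚ (a ℤ.* b) ≡ ℤ→ℚ a ℚ.* ℤ→ℚ b
  ℤ→ℚ-homo-* a b = sym (toℚᵘ≃⇒≡ℤ→ℚ (begin
    toℚᵘ (ℤ→ℚ a ℚ.* ℤ→ℚ b)          ≈⟨ ℚP.toℚᵘ-homo-* (ℤ→ℚ a) (ℤ→ℚ b) ⟩
    toℚᵘ (ℤ→ℚ a) ℚᵘ.* toℚᵘ (ℤ→ℚ b)  ≈⟨ ℚᵘP.*-cong (toℚᵘ-ℤ→ℚ a) (toℚᵘ-ℤ→ℚ b) ⟩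
    mkℚᵘ (a ℤ.* b) 0                 ∎))

  ℤ→ℚ-homo‿- : ∀ a → ℤ→ℚ (ℤ.- a) ≡ ℚ.- ℤ→ℚ a
  ℤ→ℚ-homo‿- a = sym (toℚᵘ≃⇒≡ℤ→ℚ (begin
    toℚᵘ (ℚ.- ℤ→ℚ a)    ≈⟨ ℚP.toℚᵘ-homo‿- (ℤ→ℚ a) ⟩
    ℚᵘ.- toℚᵘ (ℤ→ℚ a)   ≈⟨ ℚᵘP.-‿cong (toℚᵘ-ℤ→ℚ a) ⟩
    mkℚᵘ (ℤ.- a) 0       ∎))

  ℤ→ℚ-homo-∣-∣ : ∀ a → ℚ.∣ ℤ→ℚ a ∣ ≡ ℤ→ℚ (+ ℤ.∣ a ∣)
  ℤ→ℚ-homo-∣-∣ a = toℚᵘ≃⇒≡ℤ→ℚ (begin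
    toℚᵘ ℚ.∣ ℤ→ℚ a ∣     ≈⟨ ℚP.toℚᵘ-homo-∣-∣ (ℤ→ℚ a) ⟩
    ℚᵘ.∣ toℚᵘ (ℤ→ℚ a) ∣  ≈⟨ ℚᵘP.∣-∣-cong (toℚᵘ-ℤ→ℚ a) ⟩
    mkℚᵘ (+ ℤ.∣ a ∣) 0    ∎)

  ℤ→ℚ-*-/ : ∀ k z → ℤ→ℚ (+ suc k) ℚ.* (z / suc k) ≡ ℤ→ℚ z
  ℤ→ℚ-*-/ k z = toℚᵘ≃⇒≡ℤ→ℚ (begin
    toℚᵘ (ℤ→ℚ (+ suc k) ℚ.* (z / suc k))        ≈⟨ ℚP.toℚᵘ-homo-* (ℤ→ℚ (+ suc k)) (z / suc k) ⟩
    toℚᵘ (ℤ→ℚ (+ suc k)) ℚᵘ.* toℚᵘ (z / suc k)  ≈⟨ ℚᵘP.*-cong (toℚᵘ-ℤ→ℚ (+ suc k)) (toℚᵘ-/ z k) ⟩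
    mkℚᵘ (+ suc k) 0 ℚᵘ.* mkℚᵘ z k               ≈⟨ *≡* cross ⟩
    mkℚᵘ z 0                                     ∎)
    where
    ring : ∀ n z → (n ℤ.* z) ℤ.* + 1 ≡ z ℤ.* n
    ring = solve-∀
    cross : (+ suc k ℤ.* z) ℤ.* + 1 ≡ z ℤ.* + (1 ℕ.* suc k)
    cross rewrite ℕP.*-identityˡ (suc k) = ring (+ suc k) z

  /-*-/ : ∀ c k w → (+ suc w / suc k) ℚ.* (+ c / suc w) ≡ + c / suc k
  /-*-/ c k w = ℚP.toℚᵘ-injective (begin
    toℚᵘ ((+ suc w / suc k) ℚ.* (+ c / suc w))      ≈⟨ ℚP.toℚᵘ-homo-* (+ suc w / suc k) (+ c / suc w) ⟩
    toℚᵘ (+ suc w / suc k) ℚᵘ.* toℚᵘ (+ c / suc w)  ≈⟨ ℚᵘP.*-cong (toℚᵘ-/ (+ suc w) k) (toℚᵘ-/ (+ c) w) ⟩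
    mkℚᵘ (+ suc w) k ℚᵘ.* mkℚᵘ (+ c) w               ≈⟨ *≡* cross ⟩
    mkℚᵘ (+ c) k                                     ≈⟨ toℚᵘ-/ (+ c) k ⟨
    toℚᵘ (+ c / suc k)                               ∎)
    where
    ring : ∀ c w k → (w ℤ.* c) ℤ.* k ≡ c ℤ.* (k ℤ.* w)
    ring = solve-∀
    cross : (+ suc w ℤ.* + c) ℤ.* + suc k ≡ + c ℤ.* + (suc k ℕ.* suc w)
    cross rewrite ℤP.pos-* (suc k) (suc w) = ring (+ c) (+ suc w) (+ suc k)

  ℤ→ℚ-mono-≤ : ∀ {a b} → a ℤ.≤ b → ℤ→ℚ a ℚ.≤ ℤ→ℚ b
  ℤ→ℚ-mono-≤ {a} {b} a≤b = ℚP.toℚᵘ-cancel-≤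
    (ℚᵘP.≤-respˡ-≃ (ℚᵘP.≃-sym (toℚᵘ-ℤ→ℚ a)) (ℚᵘP.≤-respʳ-≃ (ℚᵘP.≃-sym (toℚᵘ-ℤ→ℚ b))
      (*≤* (ℤP.*-monoʳ-≤-nonNeg (+ 1) a≤b))))

  ℤ→ℚ-injective : ∀ {a b} → ℤ→ℚ a ≡ ℤ→ℚ b → a ≡ b
  ℤ→ℚ-injective {a} {b} eq
    with ℚᵘP.≃-trans (ℚᵘP.≃-sym (toℚᵘ-ℤ→ℚ a)) (ℚᵘP.≃-trans (ℚP.toℚᵘ-cong eq) (toℚᵘ-ℤ→ℚ b))
  ... | *≡* a*1≡b*1 = trans (sym (ℤP.*-identityʳ a)) (trans a*1≡b*1 (ℤP.*-identityʳ b))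

ℤ→ℚ-homo-− : ∀ a b → ℤ→ℚ (a ℤ.- b) ≡ ℤ→ℚ a ℚ.- ℤ→ℚ b
ℤ→ℚ-homo-− a b = trans (ℤ→ℚ-homo-+ a (ℤ.- b)) (cong (ℤ→ℚ a ℚ.+_) (ℤ→ℚ-homo‿- b))

ℤ→ℚ-*-∣-/∣ : ∀ k a b → ℤ→ℚ (+ suc k) ℚ.* ℚ.∣ ℤ→ℚ a ℚ.- b / suc k ∣ ≡ ℤ→ℚ (+ ℤ.∣ + suc k ℤ.* a ℤ.- b ∣)
ℤ→ℚ-*-∣-/∣ k a b = begin
  n ℚ.* ℚ.∣ ℤ→ℚ a ℚ.- b / suc k ∣         ≡⟨ cong (ℚ._* ℚ.∣ ℤ→ℚ a ℚ.- b / suc k ∣) (ℤ→ℚ-homo-∣-∣ (+ suc k)) ⟨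
  ℚ.∣ n ∣ ℚ.* ℚ.∣ ℤ→ℚ a ℚ.- b / suc k ∣   ≡⟨ ℚP.∣p*q∣≡∣p∣*∣q∣ n (ℤ→ℚ a ℚ.- b / suc k) ⟨
  ℚ.∣ n ℚ.* (ℤ→ℚ a ℚ.- b / suc k) ∣       ≡⟨ cong ℚ.∣_∣ scaled ⟩
  ℚ.∣ ℤ→ℚ (+ suc k ℤ.* a ℤ.- b) ∣         ≡⟨ ℤ→ℚ-homo-∣-∣ (+ suc k ℤ.* a ℤ.- b) ⟩
  ℤ→ℚ (+ ℤ.∣ + suc k ℤ.* a ℤ.- b ∣)       ∎
  where
  open ≡-Reasoning
  n : ℚ
  n = ℤ→ℚ (+ suc k)
  scaled : n ℚ.* (ℤ→ℚ a ℚ.- b / suc k) ≡ ℤ→ℚ (+ suc k ℤ.* a ℤ.- b)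
  scaled = begin
    n ℚ.* (ℤ→ℚ a ℚ.- b / suc k)              ≡⟨ ℚP.*-distribˡ-+ n (ℤ→ℚ a) (ℚ.- (b / suc k)) ⟩
    n ℚ.* ℤ→ℚ a ℚ.+ n ℚ.* ℚ.- (b / suc k)    ≡⟨ cong (n ℚ.* ℤ→ℚ a ℚ.+_) (ℚP.neg-distribʳ-* n (b / suc k)) ⟨
    n ℚ.* ℤ→ℚ a ℚ.- n ℚ.* (b / suc k)        ≡⟨ cong₂ ℚ._-_ (ℤ→ℚ-homo-* (+ suc k) a) (sym (ℤ→ℚ-*-/ k b)) ⟨
    ℤ→ℚ (+ suc k ℤ.* a) ℚ.- ℤ→ℚ b          ≡⟨ ℤ→ℚ-homo-− (+ suc k ℤ.* a) b ⟨
    ℤ→ℚ (+ suc k ℤ.* a ℤ.- b)              ∎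

ℤ→ℚ-*-∑∣-/∣ : ∀ {A : Set} k (x : A → ℕ) T xs →
  ℤ→ℚ (+ suc k) ℚ.* ℚ∑.∑ (λ i → ℚ.∣ ℕ→ℚ (x i) ℚ.- + T / suc k ∣) xs
    ≡ ℤ→ℚ (∑ (λ i → + ℤ.∣ + suc k ℤ.* + x i ℤ.- + T ∣) xs)
ℤ→ℚ-*-∑∣-/∣ k x T xs = begin
  n ℚ.* ℚ∑.∑ (λ i → ℚ.∣ ℕ→ℚ (x i) ℚ.- + T / suc k ∣) xs
    ≡⟨ ℚ∑.∑-homo (n ℚ.*_) (ℚP.*-zeroʳ n) (ℚP.*-distribˡ-+ n) _ xs ⟩
  ℚ∑.∑ (λ i → n ℚ.* ℚ.∣ ℕ→ℚ (x i) ℚ.- + T / suc k ∣) xs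
    ≡⟨ ℚ∑.∑-cong (λ i → ℤ→ℚ-*-∣-/∣ k (+ x i) (+ T)) xs ⟩
  ℚ∑.∑ (λ i → ℤ→ℚ (+ ℤ.∣ + suc k ℤ.* + x i ℤ.- + T ∣)) xs
    ≡⟨ ℚ∑.∑-homo ℤ→ℚ refl ℤ→ℚ-homo-+ _ xs ⟨
  ℤ→ℚ (∑ (λ i → + ℤ.∣ + suc k ℤ.* + x i ℤ.- + T ∣) xs) ∎
  where
  open ≡-Reasoning
  n : ℚ
  n = ℤ→ℚ (+ suc k)

ℤ→ℚ-*-/-*-− : ∀ k c a b →
  ℤ→ℚ (+ suc k) ℚ.* (+ c / suc k ℚ.* (ℕ→ℚ a ℚ.- ℕ→ℚ b)) ≡ ℤ→ℚ (+ c ℤ.* (+ a ℤ.- + b))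
ℤ→ℚ-*-/-*-− k c a b = begin
  n ℚ.* (+ c / suc k ℚ.* (ℕ→ℚ a ℚ.- ℕ→ℚ b))    ≡⟨ ℚP.*-assoc n (+ c / suc k) _ ⟨
  n ℚ.* (+ c / suc k) ℚ.* (ℕ→ℚ a ℚ.- ℕ→ℚ b)    ≡⟨ cong₂ ℚ._*_ (ℤ→ℚ-*-/ k (+ c)) (sym (ℤ→ℚ-homo-− (+ a) (+ b))) ⟩
  ℤ→ℚ (+ c) ℚ.* ℤ→ℚ (+ a ℤ.- + b)              ≡⟨ ℤ→ℚ-homo-* (+ c) (+ a ℤ.- + b) ⟨
  ℤ→ℚ (+ c ℤ.* (+ a ℤ.- + b))                  ∎
  where
  open ≡-Reasoning
  n : ℚ
  n = ℤ→ℚ (+ suc k)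

module _ (k : ℕ) {p q : ℚ} {a b : ℤ} where

  private instance
    n-pos : ℚ.Positive (ℤ→ℚ (+ suc k))
    n-pos = ℚP.normalize-pos (suc k) 1

  scaled-mono-≤ : ℤ→ℚ (+ suc k) ℚ.* p ≡ ℤ→ℚ a → ℤ→ℚ (+ suc k) ℚ.* q ≡ ℤ→ℚ b → a ℤ.≤ b → p ℚ.≤ q
  scaled-mono-≤ np≡a nq≡b a≤b = ℚP.*-cancelˡ-≤-pos (ℤ→ℚ (+ suc k)) (subst₂ ℚ._≤_ (sym np≡a) (sym nq≡b) (ℤ→ℚ-mono-≤ a≤b))

  scaled-≡⇔ : ℤ→ℚ (+ suc k) ℚ.* p ≡ ℤ→ℚ a → ℤ→ℚ (+ suc k) ℚ.* q ≡ ℤ→ℚ b → (p ≡ q) ⇔ (a ≡ b)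
  scaled-≡⇔ np≡a nq≡b = mk⇔
    (λ p≡q → ℤ→ℚ-injective (trans (sym np≡a) (trans (cong (ℤ→ℚ (+ suc k) ℚ.*_) p≡q) nq≡b)))
    (λ a≡b → ℚP.≤-antisym
      (ℚP.*-cancelˡ-≤-pos (ℤ→ℚ (+ suc k)) (ℚP.≤-reflexive (trans np≡a (trans (cong ℤ→ℚ a≡b) (sym nq≡b)))))
      (ℚP.*-cancelˡ-≤-pos (ℤ→ℚ (+ suc k)) (ℚP.≤-reflexive (trans nq≡b (trans (cong ℤ→ℚ (sym a≡b)) (sym np≡a))))))

divℕ-*-factor : ∀ c k a b (D : ℚ) → 0 ℕ.< b →
  divℕ (+ c) (suc k) ℚ.* D ≡ divℕ (+ (a ℕ.+ b)) (suc k) ℚ.* (divℕ (+ c) (b ℕ.+ a) ℚ.* D)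
divℕ-*-factor c k a (suc b) D _ = begin
  + c / suc k ℚ.* D                                      ≡⟨ cong (ℚ._* D) (/-*-/ c k (b ℕ.+ a)) ⟨
  + m / suc k ℚ.* (+ c / m) ℚ.* D                        ≡⟨ ℚP.*-assoc (+ m / suc k) (+ c / m) D ⟩
  + m / suc k ℚ.* (+ c / m ℚ.* D)                        ≡⟨ cong (λ l → divℕ (+ l) (suc k) ℚ.* (+ c / m ℚ.* D)) a+suc-b≡m ⟨
  divℕ (+ (a ℕ.+ suc b)) (suc k) ℚ.* (+ c / m ℚ.* D)    ∎
  where
  open ≡-Reasoning
  m : ℕ
  m = suc (b ℕ.+ a)
  a+suc-b≡m : a ℕ.+ suc b ≡ m
  a+suc-b≡m = trans (ℕP.+-suc a b) (cong suc (ℕP.+-comm a b))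

theorem4 : (k : ℕ) (G : SimpleGraph (suc k)) →
    (divℕ (+ (2 Data.Nat.* NΔ G Data.Nat.* Nδ G)) (suc k) * (ℕ→ℚ (maxDeg G) Data.Rational.- ℕ→ℚ (minDeg G)) ≤ S G)
    × (divℕ (+ (2 Data.Nat.* NΔ G Data.Nat.* Nδ G)) (suc k) * (ℕ→ℚ (maxDeg G) Data.Rational.- ℕ→ℚ (minDeg G))
        ≡ divℕ (+ (NΔ G Data.Nat.+ Nδ G)) (suc k) * IRD G)
    × ((S G ≡ divℕ (+ (2 Data.Nat.* NΔ G Data.Nat.* Nδ G)) (suc k) * (ℕ→ℚ (maxDeg G) Data.Rational.- ℕ→ℚ (minDeg G)))
        ⇔ (Regular G ⊎ TwoDegrees G))
theorem4 k G =
  scaled-mono-≤ k n*bound≡gap n*S≡spread gap≤spread ,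
  divℕ-*-factor (2 ℕ.* NΔ G ℕ.* Nδ G) k (NΔ G) (Nδ G) _ (mult-pos (minDeg-attained G)) ,
  extremal⇔regular⊎twoDegrees G
    ⇔-∘ (spread≡gap⇔extremal (maxDeg-attained G) (minDeg-attained G)
    ⇔-∘ scaled-≡⇔ k n*S≡spread n*bound≡gap)
  where
  open DegreeSequence (deg G) (maxDeg G) (minDeg G) (minDeg≤deg G) (deg≤maxDeg G)

  n*S≡spread : ℤ→ℚ (+ suc k) ℚ.* S G ≡ ℤ→ℚ spread
  n*S≡spread = subst (λ T → ℤ→ℚ (+ suc k) ℚ.* S G ≡ ℤ→ℚ (∑ (λ i → + ℤ.∣ + suc k ℤ.* + deg G i ℤ.- + T ∣) V))
                     (sym (handshake G)) (ℤ→ℚ-*-∑∣-/∣ k (deg G) (2 ℕ.* edges G) V)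

  n*bound≡gap : ℤ→ℚ (+ suc k) ℚ.* (divℕ (+ (2 ℕ.* NΔ G ℕ.* Nδ G)) (suc k) ℚ.* (ℕ→ℚ (maxDeg G) ℚ.- ℕ→ℚ (minDeg G)))
                ≡ ℤ→ℚ gap
  n*bound≡gap = ℤ→ℚ-*-/-*-− k (2 ℕ.* NΔ G ℕ.* Nδ G) (maxDeg G) (minDeg G)
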